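{- Let $n \geq 2$, $m \in \mathbb{N}$, and let $G_1,\ldots,G_n$ be vertex-disjoint graphs with $u_i \in V(G_i)$ for each $i \in [n]$; let $G$ be obtained from their disjoint union by identifying $u_1,\ldots,u_n$ as a single vertex $u$. Suppose that for each $i \in [n]$ and every $m$-fold cover $\mathcal{H}_i=(L_i,H_i)$ of $G_i$, $N(s,\mathcal{H}_i) \geq P_{DP}(G_i,m)/m$ for each $s \in L_i(u_i)$. Then \[ P_{DP}(G,m) = \frac{\prod_{i=1}^{n} P_{DP}(G_i,m)}{m^{n-1}}. \]
   Context: All graphs are finite and simple. A cover of a graph $G$ is a pair $\mathcal{H}=(L,H)$ where $H$ is a graph and $L: V(G) \to \mathcal{P}(V(H))$ satisfies: (1) $\{L(u): u \in V(G)\}$ is a partition of $V(H)$ into $|V(G)|$ parts; (2) $H[L(u)]$ is complete for each $u$; (3) if there is an edge of $H$ between $L(u)$ and $L(v)$ with $u \neq v$, then $uv \in E(G)$; (4) if $uv \in E(G)$, the edges of $H$ between $L(u)$ and $L(v)$ form a (possibly empty) matching. The cover is $m$-fold if $|L(u)|=m$ for all $u$. An $\mathcal{H}$-coloring of $G$ is an independent set of $H$ of size $|V(G)|$. $P_{DP}(G,m)$ is the minimum number of $\mathcal{H}$-colorings over all $m$-fold covers. For $s \in V(H)$, $N(s,\mathcal{H})$ is the number of $\mathcal{H}$-colorings containing $s$. -}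

module Defs where

open import Data.Nat using (ℕ; zero; suc; _+_; _*_; _≤_)
open import Data.Fin using (Fin; zero; suc; _≟_)
open import Data.Bool using (Bool; true; false; not; _∧_; if_then_else_)
open import Data.Product using (Σ; _×_; _,_)
open import Data.Vec.Functional using ([]; _∷_)
open import Relation.Binary.PropositionalEquality using (_≡_; _≢_)
open import Relation.Nullary.Decidable using (⌊_⌋)

sumFin : (n : ℕ) → (Fin n → ℕ) → ℕ
sumFin zero    f = 0
sumFin (suc n) f = f zero + sumFin n (λ i → f (suc i))

prodFin : (n : ℕ) → (Fin n → ℕ) → ℕ
prodFin zero    f = 1
prodFin (suc n) f = f zero * prodFin n (λ i → f (suc i))

allFin? : (n : ℕ) → (Fin n → Bool) → Bool
allFin? zero    f = true
allFin? (suc n) f = f zero ∧ allFin? n (λ i → f (suc i))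

countFns : (k m : ℕ) → ((Fin k → Fin m) → Bool) → ℕ
countFns zero    m P = if P [] then 1 else 0
countFns (suc k) m P = sumFin m (λ a → countFns k m (λ g → P (a ∷ g)))

record Graph : Set where
  field
    size   : ℕ
    Adj    : Fin size → Fin size → Bool
    sym    : ∀ x y → Adj x y ≡ Adj y x
    irrefl : ∀ x → Adj x x ≡ false
open Graph public

-- V(H) = V(G) × Fin m, with L(u) = {u} × Fin m
-- (condition (1) holds by construction; every m-fold cover is
-- isomorphic, over G, to one of this form).

record Cover (G : Graph) (m : ℕ) : Set where
  field
    E        : Fin (size G) → Fin m → Fin (size G) → Fin m → Bool
    E-sym    : ∀ u a v b → E u a v b ≡ E v b u a
    E-irrefl : ∀ u a → E u a u a ≡ false
    clique   : ∀ u a b → a ≢ b → E u a u b ≡ true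
    cross    : ∀ u v a b → u ≢ v → E u a v b ≡ true → Adj G u v ≡ true
    matching : ∀ u v a b b′ → u ≢ v → E u a v b ≡ true → E u a v b′ ≡ true → b ≡ b′
open Cover public

-- An independent set of H of size |V(G)| contains exactly one vertex of
-- each clique L(u); we represent it by the choice function f, the set
-- being {(u , f u) : u ∈ V(G)}.  isColoring checks independence in H.
isColoring : {G : Graph} {m : ℕ} → Cover G m → (Fin (size G) → Fin m) → Bool
isColoring {G} 𝓗 f =
  allFin? (size G) (λ u → allFin? (size G) (λ v → not (E 𝓗 u (f u) v (f v))))

numColorings : {G : Graph} {m : ℕ} → Cover G m → ℕ
numColorings {G} {m} 𝓗 = countFns (size G) m (isColoring 𝓗)

N : {G : Graph} {m : ℕ} → Cover G m → Fin (size G) → Fin m → ℕ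
N {G} {m} 𝓗 u a = countFns (size G) m (λ f → isColoring 𝓗 f ∧ ⌊ f u ≟ a ⌋)

IsPDP : Graph → ℕ → ℕ → Set
IsPDP G m p = Σ (Cover G m) (λ 𝓗 → numColorings 𝓗 ≡ p)
            × ((𝓗 : Cover G m) → p ≤ numColorings 𝓗)

-- G is obtained from the disjoint union of Gs 0 … Gs (n-1) by
-- identifying the vertices us i into a single vertex w.
-- ι i embeds V(Gs i) into V(G); this characterises G up to isomorphism.

record IsGluing {n : ℕ} (Gs : Fin n → Graph) (us : (i : Fin n) → Fin (size (Gs i)))
                (G : Graph) (w : Fin (size G)) : Set where
  field
    ι        : (i : Fin n) → Fin (size (Gs i)) → Fin (size G)
    ι-u      : ∀ i → ι i (us i) ≡ w
    ι-inj    : ∀ i x y → ι i x ≡ ι i y → x ≡ y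
    ι-disj   : ∀ i j x y → i ≢ j → ι i x ≡ ι j y → x ≡ us i
    ι-surj   : ∀ z → Σ (Fin n) (λ i → Σ (Fin (size (Gs i))) (λ x → ι i x ≡ z))
    ι-adj    : ∀ i x y → Adj G (ι i x) (ι i y) ≡ Adj (Gs i) x y
    adj-ι    : ∀ z z′ → Adj G z z′ ≡ true →
               Σ (Fin n) (λ i → Σ (Fin (size (Gs i))) (λ x → Σ (Fin (size (Gs i))) (λ y →
                 ι i x ≡ z × ι i y ≡ z′)))

-- For any m-fold cover H of G, a coloring taking colour a at the glued vertex w is the same as a
-- family of colorings of the restrictions H|Gᵢ that all take colour a at uᵢ; hence
-- #colorings(H) = Σₐ Πᵢ N((uᵢ , a), H|Gᵢ).  Conversely, covers Hᵢ of the Gᵢ glue to a cover of G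
-- restricting to them.  Take each Hᵢ optimal: since Σₐ N((uᵢ , a), Hᵢ) = P_DP(Gᵢ , m), the
-- hypothesis N ≥ P_DP(Gᵢ , m)/m forces N((uᵢ , a), Hᵢ) = P_DP(Gᵢ , m)/m for every a, which by the
-- same hypothesis is the least value any cover of Gᵢ can give.  So gluing the Hᵢ minimises every
-- factor of the formula, and the glued cover has m · Πᵢ P_DP(Gᵢ , m)/m colorings.

module Submission where

open import Defs hiding (sym)
open import Data.Nat using (ℕ; zero; suc; _+_; _*_; _^_; _∸_; _≤_; z≤n)
open import Data.Nat.Properties hiding (_≟_; suc-injective)
open import Data.Fin using (Fin; zero; suc; _≟_)
open import Data.Fin.Properties using (suc-injective; any?)
open import Data.Bool using (Bool; true; false; not; _∧_; if_then_else_)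
import Data.Bool.Properties as Bool
open import Data.List using (List; []; _∷_; _++_; [_]; map; tabulate; allFin; cartesianProductWith)
open import Data.Product using (Σ; ∃; ∃₂; _×_; _,_; proj₁; proj₂)
open import Data.Vec.Functional using () renaming ([] to []ᶠ; _∷_ to _∷ᶠ_)
open import Function using (_∘_; id)
open import Relation.Binary.PropositionalEquality using (_≡_; _≢_; refl; sym; trans; cong; cong₂; _≗_; module ≡-Reasoning)
open import Relation.Nullary using (¬_; Dec; yes; no; contradiction)
open import Relation.Nullary.Decidable using (⌊_⌋; ⌊⌋-map′; _×-dec_)
open import Algebra.Properties.CommutativeSemigroup +-commutativeSemigroup using (interchange)

private
  variable
    A B C X Y : Set

𝟙 : Bool → ℕ
𝟙 b = if b then 1 else 0

𝟙-∧ : ∀ a b → 𝟙 (a ∧ b) ≡ 𝟙 a * 𝟙 b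
𝟙-∧ true  b = sym (+-identityʳ (𝟙 b))
𝟙-∧ false b = refl

𝟙≢0⇒≡true : ∀ {b} → 𝟙 b ≢ 0 → b ≡ true
𝟙≢0⇒≡true {true}  _   = refl
𝟙≢0⇒≡true {false} b≢0 = contradiction refl b≢0

𝟙*-cong : ∀ b {k l} → (b ≡ true → k ≡ l) → 𝟙 b * k ≡ 𝟙 b * l
𝟙*-cong true  k≡l = cong (1 *_) (k≡l refl)
𝟙*-cong false k≡l = refl

true-ext : {a b : Bool} → (a ≡ true → b ≡ true) → (b ≡ true → a ≡ true) → a ≡ b
true-ext {true}  {true}  _ _ = refl
true-ext {true}  {false} a⇒b _ = sym (a⇒b refl)
true-ext {false} {true}  _ b⇒a = b⇒a refl
true-ext {false} {false} _ _ = refl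

isYes-true : (a? : Dec A) → A → ⌊ a? ⌋ ≡ true
isYes-true (yes _) _ = refl
isYes-true (no ¬a) a = contradiction a ¬a

isYes-false : (a? : Dec A) → ¬ A → ⌊ a? ⌋ ≡ false
isYes-false (yes a) ¬a = contradiction a ¬a
isYes-false (no _)  _  = refl

isYes⇒ : (a? : Dec A) → ⌊ a? ⌋ ≡ true → A
isYes⇒ (yes a) _ = a

isYes-⇔ : (A → B) → (B → A) → (a? : Dec A) (b? : Dec B) → ⌊ a? ⌋ ≡ ⌊ b? ⌋
isYes-⇔ f g a? b? = true-ext (isYes-true b? ∘ f ∘ isYes⇒ a?) (isYes-true a? ∘ g ∘ isYes⇒ b?)

allFin?-sound : ∀ n {f : Fin n → Bool} → allFin? n f ≡ true → ∀ i → f i ≡ true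
allFin?-sound (suc n) all zero    = Bool.∧-conicalˡ _ _ all
allFin?-sound (suc n) all (suc i) = allFin?-sound n (Bool.∧-conicalʳ _ _ all) i

allFin?-complete : ∀ n {f : Fin n → Bool} → (∀ i → f i ≡ true) → allFin? n f ≡ true
allFin?-complete zero    _   = refl
allFin?-complete (suc n) all = cong₂ _∧_ (all zero) (allFin?-complete n (all ∘ suc))

allFin?-cong : ∀ n {f g : Fin n → Bool} → f ≗ g → allFin? n f ≡ allFin? n g
allFin?-cong zero    _   = refl
allFin?-cong (suc n) f≗g = cong₂ _∧_ (f≗g zero) (allFin?-cong n (f≗g ∘ suc))

allFin?-∧-distribʳ : ∀ n (f : Fin n → Bool) b → Fin n → allFin? n f ∧ b ≡ allFin? n (λ i → f i ∧ b)
allFin?-∧-distribʳ n f b i₀ = true-ext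
  (λ all → allFin?-complete n λ i →
     cong₂ _∧_ (allFin?-sound n (Bool.∧-conicalˡ _ _ all) i) (Bool.∧-conicalʳ _ _ all))
  (λ all → cong₂ _∧_
     (allFin?-complete n λ i → Bool.∧-conicalˡ _ _ (allFin?-sound n all i))
     (Bool.∧-conicalʳ _ _ (allFin?-sound n all i₀)))

𝟙-allFin? : ∀ n (f : Fin n → Bool) → 𝟙 (allFin? n f) ≡ prodFin n (𝟙 ∘ f)
𝟙-allFin? zero    f = refl
𝟙-allFin? (suc n) f = trans (𝟙-∧ (f zero) _) (cong (𝟙 (f zero) *_) (𝟙-allFin? n (f ∘ suc)))

sumFin-cong : ∀ n {f g : Fin n → ℕ} → f ≗ g → sumFin n f ≡ sumFin n g
sumFin-cong zero    _   = refl
sumFin-cong (suc n) f≗g = cong₂ _+_ (f≗g zero) (sumFin-cong n (f≗g ∘ suc))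

sumFin-≤ : ∀ n {f g : Fin n → ℕ} → (∀ i → f i ≤ g i) → sumFin n f ≤ sumFin n g
sumFin-≤ zero    _   = z≤n
sumFin-≤ (suc n) f≤g = +-mono-≤ (f≤g zero) (sumFin-≤ n (f≤g ∘ suc))

sumFin-const : ∀ n c → sumFin n (λ _ → c) ≡ n * c
sumFin-const zero    c = refl
sumFin-const (suc n) c = cong (c +_) (sumFin-const n c)

sumFin-*ˡ : ∀ n c (f : Fin n → ℕ) → sumFin n (λ i → c * f i) ≡ c * sumFin n f
sumFin-*ˡ zero    c f = sym (*-zeroʳ c)
sumFin-*ˡ (suc n) c f =
  trans (cong (c * f zero +_) (sumFin-*ˡ n c (f ∘ suc))) (sym (*-distribˡ-+ c (f zero) _))

prodFin-cong : ∀ n {f g : Fin n → ℕ} → f ≗ g → prodFin n f ≡ prodFin n g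
prodFin-cong zero    _   = refl
prodFin-cong (suc n) f≗g = cong₂ _*_ (f≗g zero) (prodFin-cong n (f≗g ∘ suc))

prodFin-≤ : ∀ n {f g : Fin n → ℕ} → (∀ i → f i ≤ g i) → prodFin n f ≤ prodFin n g
prodFin-≤ zero    _   = ≤-refl
prodFin-≤ (suc n) f≤g = *-mono-≤ (f≤g zero) (prodFin-≤ n (f≤g ∘ suc))

prodFin-*ˡ : ∀ n c (f : Fin n → ℕ) → prodFin n (λ i → c * f i) ≡ c ^ n * prodFin n f
prodFin-*ˡ zero    c f = refl
prodFin-*ˡ (suc n) c f =
  trans (cong (c * f zero *_) (prodFin-*ˡ n c (f ∘ suc))) ([m*n]*[o*p]≡[m*o]*[n*p] c (f zero) (c ^ n) _)

all≥∧sumFin≤⇒all≡ : ∀ n (f : Fin n → ℕ) c → (∀ i → c ≤ f i) → sumFin n f ≤ n * c → ∀ i → f i ≡ c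
all≥∧sumFin≤⇒all≡ (suc n) f c c≤f sum≤ = pointwise
  where
  rest≥ : n * c ≤ sumFin n (f ∘ suc)
  rest≥ = ≤-trans (≤-reflexive (sym (sumFin-const n c))) (sumFin-≤ n (c≤f ∘ suc))
  pointwise : ∀ i → f i ≡ c
  pointwise zero    = ≤-antisym (+-cancelʳ-≤ (n * c) (f zero) c (≤-trans (+-monoʳ-≤ (f zero) rest≥) sum≤)) (c≤f zero)
  pointwise (suc i) = all≥∧sumFin≤⇒all≡ n (f ∘ suc) c (c≤f ∘ suc)
    (+-cancelˡ-≤ c _ _ (≤-trans (+-monoˡ-≤ _ (c≤f zero)) sum≤)) i

^*sumFin-prodFin : ∀ c k n (f : Fin n → Fin k → ℕ) (p : Fin n → ℕ) → (∀ i a → c * f i a ≡ p i) →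
  c ^ n * sumFin k (λ a → prodFin n (λ i → f i a)) ≡ k * prodFin n p
^*sumFin-prodFin c k n f p cf≡p = begin
  c ^ n * sumFin k (λ a → prodFin n (λ i → f i a))   ≡⟨ sumFin-*ˡ k (c ^ n) _ ⟨
  sumFin k (λ a → c ^ n * prodFin n (λ i → f i a))   ≡⟨ sumFin-cong k (λ a → sym (prodFin-*ˡ n c (λ i → f i a))) ⟩
  sumFin k (λ a → prodFin n (λ i → c * f i a))       ≡⟨ sumFin-cong k (λ a → prodFin-cong n (λ i → cf≡p i a)) ⟩
  sumFin k (λ _ → prodFin n p)                       ≡⟨ sumFin-const k (prodFin n p) ⟩
  k * prodFin n p                                    ∎
  where open ≡-Reasoning

sumList : List A → (A → ℕ) → ℕ
sumList []       f = 0
sumList (x ∷ xs) f = f x + sumList xs f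

sumList-cong : (xs : List A) {f g : A → ℕ} → f ≗ g → sumList xs f ≡ sumList xs g
sumList-cong []       _   = refl
sumList-cong (x ∷ xs) f≗g = cong₂ _+_ (f≗g x) (sumList-cong xs f≗g)

sumList-0 : (xs : List A) → sumList xs (λ _ → 0) ≡ 0
sumList-0 []       = refl
sumList-0 (x ∷ xs) = sumList-0 xs

sumList-+ : (xs : List A) (f g : A → ℕ) → sumList xs (λ x → f x + g x) ≡ sumList xs f + sumList xs g
sumList-+ []       f g = refl
sumList-+ (x ∷ xs) f g =
  trans (cong (f x + g x +_) (sumList-+ xs f g)) (interchange (f x) (g x) (sumList xs f) (sumList xs g))

sumList-*ˡ : (xs : List A) (c : ℕ) (f : A → ℕ) → sumList xs (λ x → c * f x) ≡ c * sumList xs f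
sumList-*ˡ []       c f = sym (*-zeroʳ c)
sumList-*ˡ (x ∷ xs) c f = trans (cong (c * f x +_) (sumList-*ˡ xs c f)) (sym (*-distribˡ-+ c (f x) _))

sumList-*ʳ : (xs : List A) (c : ℕ) (f : A → ℕ) → sumList xs (λ x → f x * c) ≡ sumList xs f * c
sumList-*ʳ xs c f =
  trans (sumList-cong xs (λ x → *-comm (f x) c)) (trans (sumList-*ˡ xs c f) (*-comm c _))

sumList-++ : (xs ys : List A) (f : A → ℕ) → sumList (xs ++ ys) f ≡ sumList xs f + sumList ys f
sumList-++ []       ys f = refl
sumList-++ (x ∷ xs) ys f = trans (cong (f x +_) (sumList-++ xs ys f)) (sym (+-assoc (f x) _ _))

sumList-map : (h : A → B) (xs : List A) (f : B → ℕ) → sumList (map h xs) f ≡ sumList xs (f ∘ h)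
sumList-map h []       f = refl
sumList-map h (x ∷ xs) f = cong (f (h x) +_) (sumList-map h xs f)

sumList-swap : (xs : List A) (ys : List B) (f : A → B → ℕ) →
  sumList xs (λ x → sumList ys (f x)) ≡ sumList ys (λ y → sumList xs (λ x → f x y))
sumList-swap []       ys f = sym (sumList-0 ys)
sumList-swap (x ∷ xs) ys f =
  trans (cong (sumList ys (f x) +_) (sumList-swap xs ys f)) (sym (sumList-+ ys (f x) _))

sumList-*-sumList : (xs : List A) (ys : List B) (f : A → ℕ) (g : B → ℕ) →
  sumList xs (λ x → sumList ys (λ y → f x * g y)) ≡ sumList xs f * sumList ys g
sumList-*-sumList xs ys f g =
  trans (sumList-cong xs (λ x → sumList-*ˡ ys (f x) g)) (sumList-*ʳ xs (sumList ys g) f)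

sumList-tabulate : ∀ {n} (g : Fin n → A) (f : A → ℕ) → sumList (tabulate g) f ≡ sumFin n (f ∘ g)
sumList-tabulate {n = zero}  g f = refl
sumList-tabulate {n = suc n} g f = cong (f (g zero) +_) (sumList-tabulate (g ∘ suc) f)

sumList-allFin : ∀ n (f : Fin n → ℕ) → sumList (allFin n) f ≡ sumFin n f
sumList-allFin n = sumList-tabulate id

sumList-cartesianProductWith : (c : A → B → C) (xs : List A) (ys : List B) (f : C → ℕ) →
  sumList (cartesianProductWith c xs ys) f ≡ sumList xs (λ x → sumList ys (λ y → f (c x y)))
sumList-cartesianProductWith c []       ys f = refl
sumList-cartesianProductWith c (x ∷ xs) ys f =
  trans (sumList-++ (map (c x) ys) _ f)
        (cong₂ _+_ (sumList-map (c x) ys f) (sumList-cartesianProductWith c xs ys f))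

count : (A → Bool) → List A → ℕ
count P xs = sumList xs (𝟙 ∘ P)

count-cartesianProductWith : (c : A → B → C) (R : C → Bool) (P : A → Bool) (Q : B → Bool) →
  (∀ x y → R (c x y) ≡ P x ∧ Q y) → (xs : List A) (ys : List B) →
  count R (cartesianProductWith c xs ys) ≡ count P xs * count Q ys
count-cartesianProductWith c R P Q R≡P∧Q xs ys =
  trans (sumList-cartesianProductWith c xs ys (𝟙 ∘ R))
  (trans (sumList-cong xs (λ x → sumList-cong ys (λ y → trans (cong 𝟙 (R≡P∧Q x y)) (𝟙-∧ (P x) (Q y)))))
         (sumList-*-sumList xs ys (𝟙 ∘ P) (𝟙 ∘ Q)))

sumList-𝟙*-unique : (ys : List Y) (R : Y → Bool) (c : ℕ) →
  (c ≢ 0 → count R ys ≡ 1) → sumList ys (λ y → 𝟙 (R y) * c) ≡ c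
sumList-𝟙*-unique ys R zero      _      = trans (sumList-*ʳ ys 0 (𝟙 ∘ R)) (*-zeroʳ (count R ys))
sumList-𝟙*-unique ys R c@(suc _) unique =
  trans (sumList-*ʳ ys c (𝟙 ∘ R)) (trans (cong (_* c) (unique λ ())) (*-identityˡ c))

double-counting : (xs : List X) (ys : List Y) (R : X → Y → Bool) (F : X → ℕ) (G : Y → ℕ) →
  (∀ x y → R x y ≡ true → F x ≡ G y) →
  (∀ x → F x ≢ 0 → count (R x) ys ≡ 1) →
  (∀ y → G y ≢ 0 → count (λ x → R x y) xs ≡ 1) →
  sumList xs F ≡ sumList ys G
double-counting xs ys R F G F≡G unique-y unique-x = begin
  sumList xs F
    ≡⟨ sumList-cong xs (λ x → sumList-𝟙*-unique ys (R x) (F x) (unique-y x)) ⟨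
  sumList xs (λ x → sumList ys (λ y → 𝟙 (R x y) * F x))
    ≡⟨ sumList-swap xs ys _ ⟩
  sumList ys (λ y → sumList xs (λ x → 𝟙 (R x y) * F x))
    ≡⟨ sumList-cong ys (λ y → sumList-cong xs (λ x → 𝟙*-cong (R x y) (F≡G x y))) ⟩
  sumList ys (λ y → sumList xs (λ x → 𝟙 (R x y) * G y))
    ≡⟨ sumList-cong ys (λ y → sumList-𝟙*-unique xs (λ x → R x y) (G y) (unique-x y)) ⟩
  sumList ys G
    ∎
  where open ≡-Reasoning

Enumerates : (A → A → Bool) → List A → Set
Enumerates eq xs = ∀ a → count (eq a) xs ≡ 1

sumFin-𝟙-≟ : ∀ m (a : Fin m) → sumFin m (λ b → 𝟙 ⌊ a ≟ b ⌋) ≡ 1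
sumFin-𝟙-≟ (suc m) zero    = cong suc (trans (sumFin-const m 0) (*-zeroʳ m))
sumFin-𝟙-≟ (suc m) (suc a) =
  trans (sumFin-cong m (λ b → cong 𝟙 (⌊⌋-map′ (cong suc) suc-injective (a ≟ b)))) (sumFin-𝟙-≟ m a)

allFin-enumerates : ∀ m → Enumerates (λ a b → ⌊ a ≟ b ⌋) (allFin m)
allFin-enumerates m a = trans (sumList-allFin m _) (sumFin-𝟙-≟ m a)

eqFn : {k m : ℕ} → (Fin k → Fin m) → (Fin k → Fin m) → Bool
eqFn {k} f g = allFin? k (λ i → ⌊ f i ≟ g i ⌋)

eqFn-sound : ∀ {k m} {f g : Fin k → Fin m} → eqFn f g ≡ true → f ≗ g
eqFn-sound {k} {f = f} {g} f≐g i = isYes⇒ (f i ≟ g i) (allFin?-sound k f≐g i)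

eqFn-complete : ∀ {k m} {f g : Fin k → Fin m} → f ≗ g → eqFn f g ≡ true
eqFn-complete {k} {f = f} {g} f≗g = allFin?-complete k (λ i → isYes-true (f i ≟ g i) (f≗g i))

-- Built with the cons of Data.Vec.Functional, as countFns is, so that countFns≡count holds for
-- every predicate and not only for those respecting pointwise equality.
enumFn : (k m : ℕ) → List (Fin k → Fin m)
enumFn zero    m = [ []ᶠ ]
enumFn (suc k) m = cartesianProductWith _∷ᶠ_ (allFin m) (enumFn k m)

enumFn-enumerates : ∀ k m → Enumerates eqFn (enumFn k m)
enumFn-enumerates zero    m f = refl
enumFn-enumerates (suc k) m f =
  trans (count-cartesianProductWith _∷ᶠ_ (eqFn f) _ (eqFn (f ∘ suc)) (λ _ _ → refl) (allFin m) (enumFn k m))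
        (cong₂ _*_ (allFin-enumerates m (f zero)) (enumFn-enumerates k m (f ∘ suc)))

countFns≡count : ∀ k m (P : (Fin k → Fin m) → Bool) → countFns k m P ≡ count P (enumFn k m)
countFns≡count zero    m P = sym (+-identityʳ _)
countFns≡count (suc k) m P = begin
  sumFin m (λ a → countFns k m (P ∘ (a ∷ᶠ_)))
    ≡⟨ sumFin-cong m (λ a → countFns≡count k m (P ∘ (a ∷ᶠ_))) ⟩
  sumFin m (λ a → count (P ∘ (a ∷ᶠ_)) (enumFn k m))
    ≡⟨ sumList-allFin m _ ⟨
  sumList (allFin m) (λ a → count (P ∘ (a ∷ᶠ_)) (enumFn k m))
    ≡⟨ sumList-cartesianProductWith _∷ᶠ_ (allFin m) (enumFn k m) (𝟙 ∘ P) ⟨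
  count P (enumFn (suc k) m)
    ∎
  where open ≡-Reasoning

countFns-cong : ∀ k m {P Q : (Fin k → Fin m) → Bool} → P ≗ Q → countFns k m P ≡ countFns k m Q
countFns-cong k m {P} {Q} P≗Q = begin
  countFns k m P        ≡⟨ countFns≡count k m P ⟩
  count P (enumFn k m)  ≡⟨ sumList-cong (enumFn k m) (cong 𝟙 ∘ P≗Q) ⟩
  count Q (enumFn k m)  ≡⟨ countFns≡count k m Q ⟨
  countFns k m Q        ∎
  where open ≡-Reasoning

countFns-by-value : ∀ k m (P : (Fin k → Fin m) → Bool) (u : Fin k) →
  sumFin m (λ a → countFns k m (λ f → P f ∧ ⌊ f u ≟ a ⌋)) ≡ countFns k m P
countFns-by-value k m P u = begin
  sumFin m (λ a → countFns k m (λ f → P f ∧ ⌊ f u ≟ a ⌋))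
    ≡⟨ sumFin-cong m (λ a → countFns≡count k m _) ⟩
  sumFin m (λ a → count (λ f → P f ∧ ⌊ f u ≟ a ⌋) (enumFn k m))
    ≡⟨ sumList-allFin m _ ⟨
  sumList (allFin m) (λ a → count (λ f → P f ∧ ⌊ f u ≟ a ⌋) (enumFn k m))
    ≡⟨ sumList-swap (allFin m) (enumFn k m) _ ⟩
  sumList (enumFn k m) (λ f → sumList (allFin m) (λ a → 𝟙 (P f ∧ ⌊ f u ≟ a ⌋)))
    ≡⟨ sumList-cong (enumFn k m) one-value ⟩
  count P (enumFn k m)
    ≡⟨ countFns≡count k m P ⟨
  countFns k m P
    ∎
  where
  open ≡-Reasoning
  one-value : ∀ f → sumList (allFin m) (λ a → 𝟙 (P f ∧ ⌊ f u ≟ a ⌋)) ≡ 𝟙 (P f)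
  one-value f =
    trans (sumList-cong (allFin m) (λ a → 𝟙-∧ (P f) ⌊ f u ≟ a ⌋))
    (trans (sumList-*ˡ (allFin m) (𝟙 (P f)) _)
    (trans (cong (𝟙 (P f) *_) (allFin-enumerates m (f u))) (*-identityʳ _)))

consΠ : ∀ {n} {B : Fin (suc n) → Set} → B zero → ((i : Fin n) → B (suc i)) → (i : Fin (suc n)) → B i
consΠ x f zero    = x
consΠ x f (suc i) = f i

enumΠ : ∀ n {B : Fin n → Set} → ((i : Fin n) → List (B i)) → List ((i : Fin n) → B i)
enumΠ zero    es = [ (λ ()) ]
enumΠ (suc n) es = cartesianProductWith consΠ (es zero) (enumΠ n (es ∘ suc))

eqΠ : ∀ {n} {B : Fin n → Set} → ((i : Fin n) → B i → B i → Bool) →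
  ((i : Fin n) → B i) → ((i : Fin n) → B i) → Bool
eqΠ {n} eq f g = allFin? n (λ i → eq i (f i) (g i))

enumΠ-enumerates : ∀ n {B : Fin n → Set} (eq : (i : Fin n) → B i → B i → Bool) (es : (i : Fin n) → List (B i)) →
  (∀ i → Enumerates (eq i) (es i)) → Enumerates (eqΠ eq) (enumΠ n es)
enumΠ-enumerates zero    eq es _    f = refl
enumΠ-enumerates (suc n) eq es enum f =
  trans (count-cartesianProductWith consΠ (eqΠ eq f) _ (eqΠ (eq ∘ suc) (f ∘ suc)) (λ _ _ → refl)
                                    (es zero) (enumΠ n (es ∘ suc)))
        (cong₂ _*_ (enum zero (f zero)) (enumΠ-enumerates n (eq ∘ suc) (es ∘ suc) (enum ∘ suc) (f ∘ suc)))

sumList-enumΠ-prodFin : ∀ n {B : Fin n → Set} (es : (i : Fin n) → List (B i)) (h : (i : Fin n) → B i → ℕ) →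
  sumList (enumΠ n es) (λ f → prodFin n (λ i → h i (f i))) ≡ prodFin n (λ i → sumList (es i) (h i))
sumList-enumΠ-prodFin zero    es h = refl
sumList-enumΠ-prodFin (suc n) {B} es h =
  trans (sumList-cartesianProductWith (consΠ {B = B}) (es zero) (enumΠ n (es ∘ suc)) _)
  (trans (sumList-*-sumList (es zero) (enumΠ n (es ∘ suc)) (h zero) (λ f → prodFin n (λ i → h (suc i) (f i))))
         (cong (sumList (es zero) (h zero) *_) (sumList-enumΠ-prodFin n (es ∘ suc) (h ∘ suc))))

module _ {G : Graph} {m : ℕ} (H : Cover G m) where

  isColoring-sound : ∀ f → isColoring H f ≡ true → ∀ u v → E H u (f u) v (f v) ≡ false
  isColoring-sound f col u v = Bool.not-injective (allFin?-sound (size G) (allFin?-sound (size G) col u) v)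

  isColoring-complete : ∀ f → (∀ u v → E H u (f u) v (f v) ≡ false) → isColoring H f ≡ true
  isColoring-complete f indep =
    allFin?-complete (size G) (λ u → allFin?-complete (size G) (λ v → cong not (indep u v)))

  isColoring-cong : ∀ {f g} → f ≗ g → isColoring H f ≡ isColoring H g
  isColoring-cong f≗g = allFin?-cong (size G) (λ u → allFin?-cong (size G) (λ v →
    cong not (cong₂ (λ a b → E H u a v b) (f≗g u) (f≗g v))))

  numColorings≡sumFin-N : ∀ u → numColorings H ≡ sumFin m (N H u)
  numColorings≡sumFin-N u = sym (countFns-by-value (size G) m (isColoring H) u)

  N-tight : ∀ u {p} → numColorings H ≡ p → (∀ a → p ≤ m * N H u a) → ∀ a → m * N H u a ≡ p
  N-tight u {p} #H≡p p≤mN = all≥∧sumFin≤⇒all≡ m (λ a → m * N H u a) p p≤mN (≤-reflexive (begin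
    sumFin m (λ a → m * N H u a)  ≡⟨ sumFin-*ˡ m m (N H u) ⟩
    m * sumFin m (N H u)          ≡⟨ cong (m *_) (numColorings≡sumFin-N u) ⟨
    m * numColorings H            ≡⟨ cong (m *_) #H≡p ⟩
    m * p                         ∎))
    where open ≡-Reasoning

N-cong : ∀ {G m} (H₁ H₂ : Cover G m) → (∀ u a v b → E H₁ u a v b ≡ E H₂ u a v b) →
  ∀ u a → N H₁ u a ≡ N H₂ u a
N-cong {G} {m} H₁ H₂ E₁≡E₂ u a = countFns-cong (size G) m (λ f → cong (_∧ ⌊ f u ≟ a ⌋)
  (allFin?-cong (size G) (λ v → allFin?-cong (size G) (λ v′ → cong not (E₁≡E₂ v (f v) v′ (f v′))))))

module Gluing {n m : ℕ} {Gs : Fin n → Graph} {us : (i : Fin n) → Fin (size (Gs i))}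
              {G : Graph} {w : Fin (size G)} (gl : IsGluing Gs us G w) where
  open IsGluing gl

  ι-≢ : ∀ i {x y} → x ≢ y → ι i x ≢ ι i y
  ι-≢ i x≢y = x≢y ∘ ι-inj i _ _

  ι-overlap⇒w : ∀ {i j x y} → i ≢ j → ι i x ≡ ι j y → ι i x ≡ w
  ι-overlap⇒w {i} {j} {x} {y} i≢j p = trans (cong (ι i) (ι-disj i j x y i≢j p)) (ι-u i)

  restrict : Cover G m → (i : Fin n) → Cover (Gs i) m
  restrict H i = record
    { E        = λ x a y b → E H (ι i x) a (ι i y) b
    ; E-sym    = λ x a y b → E-sym H (ι i x) a (ι i y) b
    ; E-irrefl = λ x a → E-irrefl H (ι i x) a
    ; clique   = λ x a b a≢b → clique H (ι i x) a b a≢b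
    ; cross    = λ x y a b x≢y e → trans (sym (ι-adj i x y)) (cross H (ι i x) (ι i y) a b (ι-≢ i x≢y) e)
    ; matching = λ x y a b b′ x≢y → matching H (ι i x) (ι i y) a b b′ (ι-≢ i x≢y)
    }

  module _ (H : Cover G m) where

    restrictions-independent⇒independent : ∀ x → (∀ i → isColoring (restrict H i) (x ∘ ι i) ≡ true) →
      ∀ u v → E H u (x u) v (x v) ≢ true
    restrictions-independent⇒independent x col u v e with u ≟ v
    ... | yes refl = contradiction (trans (sym e) (E-irrefl H u (x u))) λ ()
    ... | no u≢v with adj-ι u v (cross H u v (x u) (x v) u≢v e)
    ...   | i , y , y′ , refl , refl =
            contradiction (trans (sym e) (isColoring-sound (restrict H i) (x ∘ ι i) (col i) y y′)) λ ()

    isColoring-restrict : ∀ x → isColoring H x ≡ allFin? n (λ i → isColoring (restrict H i) (x ∘ ι i))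
    isColoring-restrict x = true-ext
      (λ col → allFin?-complete n λ i → isColoring-complete (restrict H i) (x ∘ ι i) λ y y′ →
         isColoring-sound H x col (ι i y) (ι i y′))
      (λ col → isColoring-complete H x λ u v →
         Bool.¬-not (restrictions-independent⇒independent x (allFin?-sound n col) u v))

    -- n ≥ 1 because w has a preimage; for n = 0 the condition on x w would be lost on the right.
    isColoring∧at-w : ∀ x a → (isColoring H x ∧ ⌊ x w ≟ a ⌋)
      ≡ allFin? n (λ i → isColoring (restrict H i) (x ∘ ι i) ∧ ⌊ x (ι i (us i)) ≟ a ⌋)
    isColoring∧at-w x a = begin
      isColoring H x ∧ ⌊ x w ≟ a ⌋
        ≡⟨ cong (_∧ ⌊ x w ≟ a ⌋) (isColoring-restrict x) ⟩
      allFin? n (λ i → isColoring (restrict H i) (x ∘ ι i)) ∧ ⌊ x w ≟ a ⌋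
        ≡⟨ allFin?-∧-distribʳ n _ _ (proj₁ (ι-surj w)) ⟩
      allFin? n (λ i → isColoring (restrict H i) (x ∘ ι i) ∧ ⌊ x w ≟ a ⌋)
        ≡⟨ allFin?-cong n (λ i → cong (λ z → isColoring (restrict H i) (x ∘ ι i) ∧ ⌊ x z ≟ a ⌋) (ι-u i)) ⟨
      allFin? n (λ i → isColoring (restrict H i) (x ∘ ι i) ∧ ⌊ x (ι i (us i)) ≟ a ⌋)
        ∎
      where open ≡-Reasoning

  Family : Set
  Family = (i : Fin n) → Fin (size (Gs i)) → Fin m

  Restricts : (Fin (size G) → Fin m) → Family → Bool
  Restricts x = eqΠ (λ _ → eqFn) (λ i → x ∘ ι i)

  overlap-agree : ∀ (gs : Family) {a} → (∀ i → gs i (us i) ≡ a) →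
    ∀ {i j x y} → ι i x ≡ ι j y → gs i x ≡ gs j y
  overlap-agree gs at-u {i} {j} {x} {y} p with i ≟ j
  ... | yes refl = cong (gs i) (ι-inj i x y p)
  ... | no i≢j rewrite ι-disj i j x y i≢j p | ι-disj j i y x (i≢j ∘ sym) (sym p) =
        trans (at-u i) (sym (at-u j))

  amalgamate : Family → Fin (size G) → Fin m
  amalgamate gs z = let (i , y , _) = ι-surj z in gs i y

  amalgamate-ι : ∀ (gs : Family) {a} → (∀ i → gs i (us i) ≡ a) → ∀ i y → amalgamate gs (ι i y) ≡ gs i y
  amalgamate-ι gs at-u i y = overlap-agree gs at-u (proj₂ (proj₂ (ι-surj (ι i y))))

  Restricts≡eqFn-amalgamate : ∀ (gs : Family) {a} → (∀ i → gs i (us i) ≡ a) →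
    ∀ x → Restricts x gs ≡ eqFn (amalgamate gs) x
  Restricts≡eqFn-amalgamate gs at-u x = true-ext
    (λ r → eqFn-complete λ z → let (i , y , p) = ι-surj z in
       trans (sym (eqFn-sound (allFin?-sound n r i) y)) (cong x p))
    (λ e → allFin?-complete n λ i → eqFn-complete λ y →
       trans (sym (eqFn-sound e (ι i y))) (amalgamate-ι gs at-u i y))

  module _ (H : Cover G m) (a : Fin m) where

    Pinned : ∀ i → (Fin (size (Gs i)) → Fin m) → Bool
    Pinned i g = isColoring (restrict H i) g ∧ ⌊ g (us i) ≟ a ⌋

    N-restrict : N H w a ≡ prodFin n (λ i → N (restrict H i) (us i) a)
    N-restrict = begin
      N H w a
        ≡⟨ countFns≡count (size G) m _ ⟩
      count (λ x → isColoring H x ∧ ⌊ x w ≟ a ⌋) (enumFn (size G) m)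
        ≡⟨ double-counting (enumFn (size G) m) families Restricts _ _ colorings-agree
             (λ x _ → enumΠ-enumerates n _ _ (λ i → enumFn-enumerates _ m) (λ i → x ∘ ι i))
             unique-amalgamation ⟩
      sumList families (λ gs → prodFin n (λ i → 𝟙 (Pinned i (gs i))))
        ≡⟨ sumList-enumΠ-prodFin n _ (λ i g → 𝟙 (Pinned i g)) ⟩
      prodFin n (λ i → count (Pinned i) (enumFn (size (Gs i)) m))
        ≡⟨ prodFin-cong n (λ i → countFns≡count _ m (Pinned i)) ⟨
      prodFin n (λ i → N (restrict H i) (us i) a)
        ∎
      where
      open ≡-Reasoning

      families : List Family
      families = enumΠ n (λ i → enumFn (size (Gs i)) m)

      colorings-agree : ∀ x gs → Restricts x gs ≡ true →
        𝟙 (isColoring H x ∧ ⌊ x w ≟ a ⌋) ≡ prodFin n (λ i → 𝟙 (Pinned i (gs i)))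
      colorings-agree x gs r = begin
        𝟙 (isColoring H x ∧ ⌊ x w ≟ a ⌋)            ≡⟨ cong 𝟙 (isColoring∧at-w H x a) ⟩
        𝟙 (allFin? n (λ i → Pinned i (x ∘ ι i))) ≡⟨ 𝟙-allFin? n _ ⟩
        prodFin n (λ i → 𝟙 (Pinned i (x ∘ ι i))) ≡⟨ prodFin-cong n (λ i → cong 𝟙 (Pinned-cong i (restriction i))) ⟩
        prodFin n (λ i → 𝟙 (Pinned i (gs i)))    ∎
        where
        restriction : ∀ i → x ∘ ι i ≗ gs i
        restriction i = eqFn-sound (allFin?-sound n r i)
        Pinned-cong : ∀ i {g g′} → g ≗ g′ → Pinned i g ≡ Pinned i g′
        Pinned-cong i g≗g′ =
          cong₂ _∧_ (isColoring-cong (restrict H i) g≗g′) (cong (λ c → ⌊ c ≟ a ⌋) (g≗g′ (us i)))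

      unique-amalgamation : ∀ gs → prodFin n (λ i → 𝟙 (Pinned i (gs i))) ≢ 0 →
        count (λ x → Restricts x gs) (enumFn (size G) m) ≡ 1
      unique-amalgamation gs ≢0 =
        trans (sumList-cong (enumFn (size G) m) (cong 𝟙 ∘ Restricts≡eqFn-amalgamate gs at-u))
              (enumFn-enumerates (size G) m (amalgamate gs))
        where
        colors : ∀ i → Pinned i (gs i) ≡ true
        colors = allFin?-sound n (𝟙≢0⇒≡true (≢0 ∘ trans (sym (𝟙-allFin? n _))))
        at-u : ∀ i → gs i (us i) ≡ a
        at-u i = isYes⇒ (gs i (us i) ≟ a) (Bool.∧-conicalʳ _ _ (colors i))

  numColorings-restrict : (H : Cover G m) → numColorings H ≡ sumFin m (λ a → prodFin n (λ i → N (restrict H i) (us i) a))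
  numColorings-restrict H = trans (numColorings≡sumFin-N H w) (sumFin-cong m (N-restrict H))

  module _ (Hs : (i : Fin n) → Cover (Gs i) m) where

    -- The edges of the Hᵢ transported along ιᵢ.  This already includes the cliques on the lists
    -- L(z): every z has a preimage in some Gᵢ, where L is a clique.
    Link : Fin (size G) → Fin m → Fin (size G) → Fin m → Set
    Link z a z′ b = ∃ λ i → ∃₂ λ y y′ → ι i y ≡ z × ι i y′ ≡ z′ × E (Hs i) y a y′ b ≡ true

    link? : ∀ z a z′ b → Dec (Link z a z′ b)
    link? z a z′ b = any? λ i → any? λ y → any? λ y′ →
      ι i y ≟ z ×-dec ι i y′ ≟ z′ ×-dec E (Hs i) y a y′ b Bool.≟ true

    link-sym : ∀ {z a z′ b} → Link z a z′ b → Link z′ b z a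
    link-sym (i , y , y′ , p , p′ , e) = i , y′ , y , p′ , p , trans (E-sym (Hs i) y′ _ y _) e

    link-loop⇒≢ : ∀ {z a b} → Link z a z b → a ≢ b
    link-loop⇒≢ (i , y , y′ , p , p′ , e) refl with ι-inj i y y′ (trans p (sym p′))
    ... | refl = contradiction (trans (sym e) (E-irrefl (Hs i) y _)) λ ()

    glue : Cover G m
    glue = record
      { E        = λ z a z′ b → ⌊ link? z a z′ b ⌋
      ; E-sym    = λ z a z′ b → isYes-⇔ link-sym link-sym (link? z a z′ b) (link? z′ b z a)
      ; E-irrefl = λ z a → isYes-false (link? z a z a) (λ l → link-loop⇒≢ l refl)
      ; clique   = λ z a b a≢b → let (i , y , p) = ι-surj z in
                     isYes-true (link? z a z b) (i , y , y , p , p , clique (Hs i) y a b a≢b)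
      ; cross    = λ z z′ a b z≢z′ → link-cross z≢z′ ∘ isYes⇒ (link? z a z′ b)
      ; matching = λ z z′ a b b′ z≢z′ l l′ →
                     link-matching z≢z′ (isYes⇒ (link? z a z′ b) l) (isYes⇒ (link? z a z′ b′) l′)
      }
      where
      link-cross : ∀ {z z′ a b} → z ≢ z′ → Link z a z′ b → Adj G z z′ ≡ true
      link-cross z≢z′ (i , y , y′ , refl , refl , e) =
        trans (ι-adj i y y′) (cross (Hs i) y y′ _ _ (z≢z′ ∘ cong (ι i)) e)

      link-matching : ∀ {z z′ a b b′} → z ≢ z′ → Link z a z′ b → Link z a z′ b′ → b ≡ b′
      link-matching z≢z′ (i , y , y′ , refl , refl , e) (j , x , x′ , p , p′ , e′) with i ≟ j
      ... | yes refl rewrite ι-inj i x y p | ι-inj i x′ y′ p′ =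
            matching (Hs i) y y′ _ _ _ (z≢z′ ∘ cong (ι i)) e e′
      ... | no i≢j = contradiction (trans (ι-overlap⇒w i≢j (sym p)) (sym (ι-overlap⇒w i≢j (sym p′)))) z≢z′

    restrict-glue : ∀ i y a y′ b → E (restrict glue i) y a y′ b ≡ E (Hs i) y a y′ b
    restrict-glue i y a y′ b = true-ext
      (from-link (y ≟ y′) ∘ isYes⇒ (link? (ι i y) a (ι i y′) b))
      (λ e → isYes-true (link? (ι i y) a (ι i y′) b) (i , y , y′ , refl , refl , e))
      where
      from-link : Dec (y ≡ y′) → Link (ι i y) a (ι i y′) b → E (Hs i) y a y′ b ≡ true
      from-link (yes refl) l = clique (Hs i) y a b (link-loop⇒≢ l)
      from-link (no y≢y′) (j , x , x′ , p , p′ , e) with j ≟ i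
      ... | yes refl rewrite ι-inj j x y p | ι-inj j x′ y′ p′ = e
      ... | no j≢i = contradiction (ι-inj i y y′
              (trans (sym p) (trans (ι-overlap⇒w j≢i p) (sym (trans (sym p′) (ι-overlap⇒w j≢i p′)))))) y≢y′

    numColorings-glue : numColorings glue ≡ sumFin m (λ a → prodFin n (λ i → N (Hs i) (us i) a))
    numColorings-glue = trans (numColorings-restrict glue)
      (sumFin-cong m λ a → prodFin-cong n λ i → N-cong (restrict glue i) (Hs i) (restrict-glue i) (us i) a)

corollary3p5 : (n m : ℕ) → 2 ≤ n → 1 ≤ m →
    (Gs : Fin n → Graph) (us : (i : Fin n) → Fin (size (Gs i))) →
    (G : Graph) (w : Fin (size G)) → IsGluing Gs us G w →
    (p : Fin n → ℕ) → (∀ i → IsPDP (Gs i) m (p i)) →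
    (∀ i (𝓗 : Cover (Gs i) m) (a : Fin m) → p i ≤ m * N 𝓗 (us i) a) →
    Σ ℕ (λ q → IsPDP G m q × q * m ^ (n ∸ 1) ≡ prodFin n p)
corollary3p5 n@(suc n₁) m@(suc _) _ _ Gs us G w gl p isPDP p≤mN =
  numColorings (glue Hs) , ((glue Hs , refl) , minimal) , product-formula
  where
  open Gluing gl

  Hs : (i : Fin n) → Cover (Gs i) m
  Hs i = proj₁ (proj₁ (isPDP i))

  mN≡p : ∀ i a → m * N (Hs i) (us i) a ≡ p i
  mN≡p i = N-tight (Hs i) (us i) (proj₂ (proj₁ (isPDP i))) (p≤mN i (Hs i))

  minimal : (H : Cover G m) → numColorings (glue Hs) ≤ numColorings H
  minimal H = begin
    numColorings (glue Hs)                                        ≡⟨ numColorings-glue Hs ⟩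
    sumFin m (λ a → prodFin n (λ i → N (Hs i) (us i) a))
      ≤⟨ sumFin-≤ m (λ a → prodFin-≤ n (λ i → N-Hs≤ i a)) ⟩
    sumFin m (λ a → prodFin n (λ i → N (restrict H i) (us i) a))  ≡⟨ numColorings-restrict H ⟨
    numColorings H                                                ∎
    where
    open ≤-Reasoning
    N-Hs≤ : ∀ i a → N (Hs i) (us i) a ≤ N (restrict H i) (us i) a
    N-Hs≤ i a = *-cancelˡ-≤ m (≤-trans (≤-reflexive (mN≡p i a)) (p≤mN i (restrict H i) a))

  product-formula : numColorings (glue Hs) * m ^ n₁ ≡ prodFin n p
  product-formula = *-cancelˡ-≡ _ _ m (begin
    m * (numColorings (glue Hs) * m ^ n₁)                        ≡⟨ cong (m *_) (*-comm _ (m ^ n₁)) ⟩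
    m * (m ^ n₁ * numColorings (glue Hs))                        ≡⟨ *-assoc m (m ^ n₁) _ ⟨
    m ^ n * numColorings (glue Hs)                               ≡⟨ cong (m ^ n *_) (numColorings-glue Hs) ⟩
    m ^ n * sumFin m (λ a → prodFin n (λ i → N (Hs i) (us i) a)) ≡⟨ ^*sumFin-prodFin m m n _ p mN≡p ⟩
    m * prodFin n p                                              ∎)
    where open ≡-Reasoning
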